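{- For any integers $n\ge k\ge 1$, there exists a graph $G$ such that $|V(G)|=n$, $\mathrm{Z}_+(G)=k$, and $\mathrm{pt}_+(G)= \left\lceil \frac{n-k}{2}\right\rceil$. Thus the bound $\mathrm{pt}_+(G)\leq \left\lceil \frac{|V(G)|-\mathrm{Z}_+(G)}{2} \right\rceil$ is attained for each value of $\mathrm{Z}_+(G)$.
   Context: Graphs are finite and simple. PSD color change rule: let $B$ be the current set of blue vertices and let $W_1,\dots,W_r$ be the vertex sets of the components of $G-B$; if $u\in B$, $w\in W_i$, and $w$ is the only white neighbor of $u$ in $G[W_i\cup B]$, then $w$ may be colored blue. $B$ is a PSD forcing set if repeated application from exactly $B$ blue colors all vertices; $\mathrm{Z}_+(G)$ is the minimum size of a PSD forcing set. $B^{[0]}=B$, $B^{[i+1]}$ is $B^{[i]}$ together with all vertices that can be PSD forced when exactly $B^{[i]}$ is blue, $\mathrm{pt}_+(G;B)$ is the least $t$ with $B^{[t]}=V(G)$, and $\mathrm{pt}_+(G)=\min\{\mathrm{pt}_+(G;B):|B|=\mathrm{Z}_+(G)\}$. -}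

module Defs where

open import Level using (0ℓ)
open import Data.Nat using (ℕ; zero; suc; _≤_; _<_)
open import Data.Fin using (Fin)
open import Data.Fin.Subset using (Subset; _∈_; _∉_; _∪_; ⁅_⁆; ⊤; ∣_∣)
open import Data.Product using (Σ; ∃; _×_; _,_)
open import Data.Sum using (_⊎_)
open import Relation.Nullary using (¬_)
open import Relation.Binary.PropositionalEquality using (_≡_)
open import Relation.Binary.Construct.Closure.ReflexiveTransitive using (Star)

record Graph (n : ℕ) : Set₁ where
  field
    Adj     : Fin n → Fin n → Set
    sym     : ∀ {u v} → Adj u v → Adj v u
    irrefl  : ∀ {v} → ¬ Adj v v
open Graph public

VSet : ℕ → Set₁
VSet n = Fin n → Set

module _ {n : ℕ} (G : Graph n) where

  -- SameComp B x y : x and y are white (not in B) and lie in the same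
  -- component of G - B (connected by a path of white vertices).
  data SameComp (B : VSet n) : Fin n → Fin n → Set where
    here : ∀ {x} → ¬ B x → SameComp B x x
    step : ∀ {x y z} → SameComp B x y → Adj G y z → ¬ B z → SameComp B x z

  -- PSD color change rule: with exactly B blue, u ∈ B forces the white
  -- vertex w when w is the only white neighbour of u in G[W_i ∪ B],
  -- W_i the component of G - B containing w.
  Forces : VSet n → Fin n → Fin n → Set
  Forces B u w =
    B u × ¬ B w × Adj G u w ×
    (∀ w' → Adj G u w' → ¬ B w' → SameComp B w w' → w' ≡ w)

  CanBeForced : VSet n → Fin n → Set
  CanBeForced B w = ∃ λ u → Forces B u w

  data Step (B : Subset n) : Subset n → Set where
    force : ∀ w → CanBeForced (_∈ B) w → Step B (B ∪ ⁅ w ⁆)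

  IsPSDForcingSet : Subset n → Set
  IsPSDForcingSet B = Star Step B ⊤

  IsZplus : ℕ → Set
  IsZplus k =
    (∃ λ B → ∣ B ∣ ≡ k × IsPSDForcingSet B) ×
    (∀ B → IsPSDForcingSet B → k ≤ ∣ B ∣)

  prop : Subset n → ℕ → VSet n
  prop B zero    v = v ∈ B
  prop B (suc i) v = prop B i v ⊎ CanBeForced (prop B i) v

  Full : VSet n → Set
  Full S = ∀ v → S v

  IsPtB : Subset n → ℕ → Set
  IsPtB B t = Full (prop B t) × (∀ s → s < t → ¬ Full (prop B s))

  IsPtPlus : ℕ → Set
  IsPtPlus t = Σ ℕ λ z → IsZplus z ×
    (∃ λ B → ∣ B ∣ ≡ z × IsPtB B t) ×
    (∀ B s → ∣ B ∣ ≡ z → IsPtB B s → t ≤ s)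

-- Take j = k - 1 isolated vertices and a path on m + 1 = n - k + 1 vertices. Isolated
-- vertices are never forced, and nothing is forced without a blue path vertex, so a
-- PSD forcing set has at least j + 1 vertices; j + 1 suffice by forcing along the path.
-- In a path a blue vertex forces each white neighbour (its two sides lie in different
-- components of G - B), so with a single blue path vertex c a path vertex is blue after
-- round i exactly when it lies within distance i of c.  Both ends of the path are then
-- blue only after ⌈ m / 2 ⌉ rounds, and this is attained when c is the middle vertex.
{-# OPTIONS --safe #-}
module Submission where

open import Defs hiding (sym)
open import Data.Nat
  using (ℕ; zero; suc; _+_; _∸_; _≤_; _<_; _⊓_; _⊔_; ∣_-_∣; ⌊_/2⌋; ⌈_/2⌉; z≤n; s≤s; s≤s⁻¹; _≤?_)
open import Data.Nat.Properties
open import Data.Fin using (Fin; toℕ; fromℕ<) renaming (zero to fzero; suc to fsuc)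
open import Data.Fin.Properties using (toℕ-injective; toℕ-fromℕ<; toℕ<n) renaming (_≟_ to _≟ᶠ_)
open import Data.Fin.Subset
  using (Subset; _∈_; _∉_; _⊆_; _∪_; ⁅_⁆; ⊤; ∣_∣; inside; outside)
  renaming (⊥ to ∅)
open import Data.Fin.Subset.Properties
  using (∉⊥; ∈⊤; ∣⊥∣≡0; ∣p∣≡n⇒p≡⊤; p⊂q⇒∣p∣<∣q∣; x∈p∪q⁻; x∈p∪q⁺; x∈⁅x⁆; x∈⁅y⁆⇒x≡y; ∪-identityˡ; ∪-identityʳ)
open import Data.Vec.Base using ([]; _∷_; here; there)
open import Data.Product using (Σ; ∃; _×_; _,_)
open import Data.Sum using (_⊎_; inj₁; inj₂; [_,_]′)
import Data.Sum as Sum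
open import Function using (_∘_)
open import Relation.Nullary using (¬_; yes; no; contradiction)
open import Relation.Binary.PropositionalEquality
  using (_≡_; refl; sym; trans; cong; cong₂; subst)
open import Relation.Binary.Construct.Closure.ReflexiveTransitive using (Star; ε; _◅_)

Consecutive : ℕ → ℕ → Set
Consecutive a b = suc a ≡ b ⊎ suc b ≡ a

consecutive⇒∣-∣≡1 : ∀ {a b} → Consecutive a b → ∣ b - a ∣ ≡ 1
consecutive⇒∣-∣≡1 {a} (inj₁ refl) = trans (m≤n⇒∣n-m∣≡n∸m (n≤1+n a)) (m+n∸n≡m 1 a)
consecutive⇒∣-∣≡1 {b = b} (inj₂ refl) = trans (m≤n⇒∣m-n∣≡n∸m (n≤1+n b)) (m+n∸n≡m 1 b)

step-toward : ∀ a c {d} → ∣ a - c ∣ ≡ suc d →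
              ∃ λ b → Consecutive b a × ∣ b - c ∣ ≡ d × a ⊓ c ≤ b × b ≤ a ⊔ c
step-toward zero    (suc c) refl = 1 , inj₂ refl , refl , z≤n , s≤s z≤n
step-toward (suc a) zero    refl = a , inj₁ refl , ∣-∣-identityʳ a , z≤n , n≤1+n a
step-toward (suc a) (suc c) eq with step-toward a c eq
... | b , b~a , d≡ , lo , hi = suc b , Sum.map (cong suc) (cong suc) b~a , d≡ , s≤s lo , s≤s hi

∣-⌊/2⌋∣≤⌈/2⌉ : ∀ {x} m → x ≤ m → ∣ x - ⌊ m /2⌋ ∣ ≤ ⌈ m /2⌉
∣-⌊/2⌋∣≤⌈/2⌉ {x} m x≤m with ∣m-n∣≡[m∸n]∨[n∸m] x ⌊ m /2⌋
... | inj₁ eq = begin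
  ∣ x - ⌊ m /2⌋ ∣ ≡⟨ eq ⟩
  x ∸ ⌊ m /2⌋     ≤⟨ ∸-monoˡ-≤ ⌊ m /2⌋ x≤m ⟩
  m ∸ ⌊ m /2⌋     ≡⟨ cong (_∸ ⌊ m /2⌋) (sym (⌊n/2⌋+⌈n/2⌉≡n m)) ⟩
  ⌊ m /2⌋ + ⌈ m /2⌉ ∸ ⌊ m /2⌋ ≡⟨ m+n∸m≡n ⌊ m /2⌋ ⌈ m /2⌉ ⟩
  ⌈ m /2⌉         ∎
  where open ≤-Reasoning
... | inj₂ eq = begin
  ∣ x - ⌊ m /2⌋ ∣ ≡⟨ eq ⟩
  ⌊ m /2⌋ ∸ x     ≤⟨ m∸n≤m ⌊ m /2⌋ x ⟩
  ⌊ m /2⌋         ≤⟨ ⌊n/2⌋≤⌈n/2⌉ m ⟩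
  ⌈ m /2⌉         ∎
  where open ≤-Reasoning

initial : ∀ {n} → ℕ → Subset n
initial zero              = ∅
initial {zero}  (suc j)   = []
initial {suc n} (suc j)   = inside ∷ initial j

∈-initial⁺ : ∀ {n j} {v : Fin n} → toℕ v < j → v ∈ initial j
∈-initial⁺ {j = suc j} {fzero}  _  = here
∈-initial⁺ {j = suc j} {fsuc v} lt = there (∈-initial⁺ (s≤s⁻¹ lt))

∈-initial⁻ : ∀ {n j} {v : Fin n} → v ∈ initial j → toℕ v < j
∈-initial⁻ {j = zero}  v∈ = contradiction v∈ ∉⊥
∈-initial⁻ {j = suc j} here = s≤s z≤n
∈-initial⁻ {j = suc j} (there v∈) = s≤s (∈-initial⁻ v∈)

∣initial∣ : ∀ {n} j → j ≤ n → ∣ initial {n} j ∣ ≡ j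
∣initial∣ {n} zero    _         = ∣⊥∣≡0 n
∣initial∣     (suc j) (s≤s j≤n) = cong suc (∣initial∣ j j≤n)

initial-full : ∀ n → initial {n} n ≡ ⊤
initial-full n = ∣p∣≡n⇒p≡⊤ (∣initial∣ n ≤-refl)

initial-extend : ∀ {n i} (w : Fin n) → toℕ w ≡ i → initial i ∪ ⁅ w ⁆ ≡ initial (suc i)
initial-extend fzero    refl = cong (inside ∷_) (∪-identityˡ ∅)
initial-extend (fsuc w) refl = cong (inside ∷_) (initial-extend w refl)

∣p∪⁅x⁆∣≡1+∣p∣ : ∀ {n} {p : Subset n} {x} → x ∉ p → ∣ p ∪ ⁅ x ⁆ ∣ ≡ suc ∣ p ∣
∣p∪⁅x⁆∣≡1+∣p∣ {p = outside ∷ p} {fzero}  _   = cong (suc ∘ ∣_∣) (∪-identityʳ p)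
∣p∪⁅x⁆∣≡1+∣p∣ {p = inside  ∷ p} {fzero}  x∉p = contradiction here x∉p
∣p∪⁅x⁆∣≡1+∣p∣ {p = outside ∷ p} {fsuc x} x∉p = ∣p∪⁅x⁆∣≡1+∣p∣ (x∉p ∘ there)
∣p∪⁅x⁆∣≡1+∣p∣ {p = inside  ∷ p} {fsuc x} x∉p = cong suc (∣p∪⁅x⁆∣≡1+∣p∣ (x∉p ∘ there))

∈⇒prop : ∀ {n} (G : Graph n) B i {v} → v ∈ B → prop G B i v
∈⇒prop G B zero    v∈ = v∈
∈⇒prop G B (suc i) v∈ = inj₁ (∈⇒prop G B i v∈)

-- j isolated vertices 0, …, j-1 followed by the path j — j+1 — ⋯ — j+m

module IsolatedPlusPath (j m : ℕ) where

  n : ℕ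
  n = suc (j + m)

  OnPath : Fin n → Set
  OnPath v = j ≤ toℕ v

  G : Graph n
  G = record
    { Adj    = λ u v → OnPath u × OnPath v × Consecutive (toℕ u) (toℕ v)
    ; sym    = λ (pu , pv , u~v) → pv , pu , Sum.swap u~v
    ; irrefl = λ { (_ , _ , inj₁ e) → 1+n≢n e ; (_ , _ , inj₂ e) → 1+n≢n e }
    }

  vertex : ∀ b → b ≤ j + m → Fin n
  vertex b b≤ = fromℕ< (s≤s b≤)

  toℕ-vertex : ∀ {b} (b≤ : b ≤ j + m) → toℕ (vertex b b≤) ≡ b
  toℕ-vertex b≤ = toℕ-fromℕ< (s≤s b≤)

  first : Fin n
  first = vertex j (m≤m+n j m)

  first-onPath : OnPath first
  first-onPath = ≤-reflexive (sym (toℕ-vertex (m≤m+n j m)))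

  onPath∉initial : ∀ {v} → OnPath v → v ∉ initial j
  onPath∉initial pv v∈ = <⇒≱ (∈-initial⁻ v∈) pv

  blue-separates-right : ∀ {S : VSet n} {c x y} →
                         S c → SameComp G S x y → toℕ c < toℕ x → toℕ c < toℕ y
  blue-separates-right Sc (here _) c<x = c<x
  blue-separates-right Sc (step sc (_ , _ , inj₁ e) _) c<x =
    <-trans (blue-separates-right Sc sc c<x) (≤-reflexive e)
  blue-separates-right {S} Sc (step sc (_ , _ , inj₂ e) ¬Sz) c<x
    with m≤n⇒m<n∨m≡n (s≤s⁻¹ (≤-trans (blue-separates-right Sc sc c<x) (≤-reflexive (sym e))))
  ... | inj₁ c<z = c<z
  ... | inj₂ c≡z = contradiction (subst S (toℕ-injective c≡z) Sc) ¬Sz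

  blue-separates-left : ∀ {S : VSet n} {c x y} →
                        S c → SameComp G S x y → toℕ x < toℕ c → toℕ y < toℕ c
  blue-separates-left Sc (here _) x<c = x<c
  blue-separates-left Sc (step sc (_ , _ , inj₂ e) _) x<c =
    <-trans (≤-reflexive e) (blue-separates-left Sc sc x<c)
  blue-separates-left {S} Sc (step sc (_ , _ , inj₁ e) ¬Sz) x<c
    with m≤n⇒m<n∨m≡n (subst (_≤ _) e (blue-separates-left Sc sc x<c))
  ... | inj₁ z<c = z<c
  ... | inj₂ z≡c = contradiction (subst S (sym (toℕ-injective z≡c)) Sc) ¬Sz

  -- The other neighbour of u, if white, lies beyond the blue u.
  white-neighbour-forced : ∀ {S : VSet n} {u v} → S u → Adj G u v → ¬ S v → Forces G S u v
  white-neighbour-forced {S} {u} {v} Su uv@(_ , _ , u~v) ¬Sv =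
    Su , ¬Sv , uv , λ w (_ , _ , u~w) _ → same u~v u~w
    where
    same : ∀ {w} → Consecutive (toℕ u) (toℕ v) → Consecutive (toℕ u) (toℕ w) →
           SameComp G S v w → w ≡ v
    same (inj₁ uv) (inj₁ uw) _  = toℕ-injective (trans (sym uw) uv)
    same (inj₂ vu) (inj₂ wu) _  = toℕ-injective (suc-injective (trans wu (sym vu)))
    same (inj₁ uv) (inj₂ wu) vw =
      contradiction (≤-reflexive wu) (<-asym (blue-separates-right Su vw (≤-reflexive uv)))
    same (inj₂ vu) (inj₁ uw) vw =
      contradiction (≤-reflexive uw) (<-asym (blue-separates-left Su vw (≤-reflexive vu)))

  forced-onPath : ∀ {S w} → CanBeForced G S w → OnPath w
  forced-onPath (_ , _ , _ , (_ , pw , _) , _) = pw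

  prop-isolated : ∀ B i {v} → prop G B i v → toℕ v < j → v ∈ B
  prop-isolated B zero    v∈      _   = v∈
  prop-isolated B (suc i) (inj₁ p) v<j = prop-isolated B i p v<j
  prop-isolated B (suc i) (inj₂ f) v<j = contradiction (forced-onPath f) (<⇒≱ v<j)

  star-isolated : ∀ {B C v} → Star (Step G) B C → v ∈ C → toℕ v < j → v ∈ B
  star-isolated ε v∈ _ = v∈
  star-isolated {B} (force w f ◅ r) v∈ v<j with x∈p∪q⁻ B ⁅ w ⁆ (star-isolated r v∈ v<j)
  ... | inj₁ v∈B = v∈B
  ... | inj₂ v∈w = contradiction (subst OnPath (sym (x∈⁅y⁆⇒x≡y w v∈w)) (forced-onPath f)) (<⇒≱ v<j)

  prop-meetsPath : ∀ B i {v} → prop G B i v → OnPath v → ∃ λ u → u ∈ B × OnPath u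
  prop-meetsPath B zero    {v} v∈ pv = v , v∈ , pv
  prop-meetsPath B (suc i) (inj₁ p) pv = prop-meetsPath B i p pv
  prop-meetsPath B (suc i) (inj₂ (u , Su , _ , (pu , _) , _)) _ = prop-meetsPath B i Su pu

  star-meetsPath : ∀ {B C v} → Star (Step G) B C → v ∈ C → OnPath v → ∃ λ u → u ∈ B × OnPath u
  star-meetsPath {v = v} ε v∈ pv = v , v∈ , pv
  star-meetsPath {B} (force w (u , Su , _ , (pu , _) , _) ◅ r) v∈ pv with star-meetsPath r v∈ pv
  ... | x , x∈ , px with x∈p∪q⁻ B ⁅ w ⁆ x∈
  ...   | inj₁ x∈B = x , x∈B , px
  ...   | inj₂ _   = u , Su , pu

  j≤n : j ≤ n
  j≤n = ≤-trans (m≤m+n j m) (n≤1+n (j + m))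

  onPath∈⇒j<∣B∣ : ∀ {B x} → initial j ⊆ B → x ∈ B → OnPath x → suc j ≤ ∣ B ∣
  onPath∈⇒j<∣B∣ {B} I⊆B x∈B px =
    subst (_< ∣ B ∣) (∣initial∣ j j≤n) (p⊂q⇒∣p∣<∣q∣ (I⊆B , _ , x∈B , onPath∉initial px))

  onPath-unique : ∀ {B x y} → ∣ B ∣ ≡ suc j → initial j ⊆ B →
                  x ∈ B → y ∈ B → OnPath x → OnPath y → x ≡ y
  onPath-unique {B} {x} {y} ∣B∣≡ I⊆B x∈B y∈B px py with x ≟ᶠ y
  ... | yes x≡y = x≡y
  ... | no  x≢y = contradiction (subst (suc (suc j) ≤_) ∣B∣≡ count) 1+n≰n
    where
    Ix⊆B : initial j ∪ ⁅ x ⁆ ⊆ B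
    Ix⊆B z∈ = [ I⊆B , (λ z∈x → subst (_∈ B) (sym (x∈⁅y⁆⇒x≡y x z∈x)) x∈B) ]′ (x∈p∪q⁻ _ _ z∈)
    y∉Ix : y ∉ initial j ∪ ⁅ x ⁆
    y∉Ix y∈ = [ onPath∉initial py , x≢y ∘ sym ∘ x∈⁅y⁆⇒x≡y x ]′ (x∈p∪q⁻ _ _ y∈)
    count : suc (suc j) ≤ ∣ B ∣
    count = subst (_< ∣ B ∣) (trans (∣p∪⁅x⁆∣≡1+∣p∣ (onPath∉initial px)) (cong suc (∣initial∣ j j≤n)))
                  (p⊂q⇒∣p∣<∣q∣ (Ix⊆B , y , y∈B , y∉Ix))

  prop⇒near : ∀ {B c} → (∀ {v} → v ∈ B → OnPath v → v ≡ c) →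
              ∀ i {v} → prop G B i v → OnPath v → ∣ toℕ v - toℕ c ∣ ≤ i
  prop⇒near {c = c} sole zero v∈ pv rewrite sole v∈ pv = ≤-reflexive (∣n-n∣≡0 (toℕ c))
  prop⇒near sole (suc i) (inj₁ p) pv = m≤n⇒m≤1+n (prop⇒near sole i p pv)
  prop⇒near {c = c} sole (suc i) {v} (inj₂ (u , Su , _ , (pu , _ , u~v) , _)) _ = begin
    ∣ toℕ v - toℕ c ∣                     ≤⟨ ∣-∣-triangle (toℕ v) (toℕ u) (toℕ c) ⟩
    ∣ toℕ v - toℕ u ∣ + ∣ toℕ u - toℕ c ∣ ≡⟨ cong (_+ ∣ toℕ u - toℕ c ∣) (consecutive⇒∣-∣≡1 u~v) ⟩
    suc ∣ toℕ u - toℕ c ∣                 ≤⟨ s≤s (prop⇒near sole i Su pu) ⟩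
    suc i                                 ∎
    where open ≤-Reasoning

  neighbour-toward : ∀ {i} (v c : Fin n) → OnPath v → OnPath c → ∣ toℕ v - toℕ c ∣ ≡ suc i →
                     ∃ λ u → Adj G u v × ∣ toℕ u - toℕ c ∣ ≡ i
  neighbour-toward v c pv pc d≡ with step-toward (toℕ v) (toℕ c) d≡
  ... | b , b~v , db , lo , hi = vertex b b≤ , (pu , pv , b~v′) , trans (cong (λ x → ∣ x - toℕ c ∣) tu) db
    where
    b≤ : b ≤ j + m
    b≤ = ≤-trans hi (⊔-lub (s≤s⁻¹ (toℕ<n v)) (s≤s⁻¹ (toℕ<n c)))
    tu : toℕ (vertex b b≤) ≡ b
    tu = toℕ-vertex b≤
    pu : OnPath (vertex b b≤)
    pu = subst (j ≤_) (sym tu) (≤-trans (⊓-glb pv pc) lo)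
    b~v′ : Consecutive (toℕ (vertex b b≤)) (toℕ v)
    b~v′ = subst (λ x → Consecutive x (toℕ v)) (sym tu) b~v

  near⇒prop : ∀ {B c} → (∀ {v} → v ∈ B → OnPath v → v ≡ c) → c ∈ B → OnPath c →
              ∀ i {v} → OnPath v → ∣ toℕ v - toℕ c ∣ ≤ i → prop G B i v
  near⇒prop {B} sole c∈B _ zero _ d≤0 =
    subst (_∈ B) (sym (toℕ-injective (∣m-n∣≡0⇒m≡n (n≤0⇒n≡0 d≤0)))) c∈B
  near⇒prop {B} {c} sole c∈B pc (suc i) {v} pv d≤ with m≤n⇒m<n∨m≡n d≤
  ... | inj₁ d< = inj₁ (near⇒prop sole c∈B pc i pv (s≤s⁻¹ d<))
  ... | inj₂ d≡ with neighbour-toward v c pv pc d≡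
  ...   | u , uv@(pu , _) , du = inj₂ (u , white-neighbour-forced u∈ uv v∉)
    where
    u∈ : prop G B i u
    u∈ = near⇒prop sole c∈B pc i pu (≤-reflexive du)
    v∉ : ¬ prop G B i v
    v∉ p = 1+n≰n (subst (_≤ i) d≡ (prop⇒near sole i p pv))

  j<∣forcingSet∣ : ∀ {B} → IsPSDForcingSet G B → suc j ≤ ∣ B ∣
  j<∣forcingSet∣ F with star-meetsPath F ∈⊤ first-onPath
  ... | x , x∈B , px = onPath∈⇒j<∣B∣ (λ v∈ → star-isolated F ∈⊤ (∈-initial⁻ v∈)) x∈B px

  initial-forcingSet : ∀ d i → i + d ≡ j + m → j ≤ i → IsPSDForcingSet G (initial (suc i))
  initial-forcingSet zero i eq _ = subst (IsPSDForcingSet G) (sym full) ε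
    where
    full : initial (suc i) ≡ ⊤
    full = trans (cong (initial ∘ suc) (trans (sym (+-identityʳ i)) eq)) (initial-full n)
  initial-forcingSet (suc d) i eq j≤i =
    force w (u , white-neighbour-forced u∈ (pu , pw , inj₁ u→w) w∉) ◅
    subst (IsPSDForcingSet G) (sym (initial-extend w tw))
          (initial-forcingSet d (suc i) (trans (sym (+-suc i d)) eq) (m≤n⇒m≤1+n j≤i))
    where
    i<j+m : suc i ≤ j + m
    i<j+m = ≤-trans (m≤m+n (suc i) d) (≤-reflexive (trans (sym (+-suc i d)) eq))
    u w : Fin n
    u = vertex i (<⇒≤ i<j+m)
    w = vertex (suc i) i<j+m
    tu : toℕ u ≡ i
    tu = toℕ-vertex (<⇒≤ i<j+m)
    tw : toℕ w ≡ suc i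
    tw = toℕ-vertex i<j+m
    pu : OnPath u
    pu = subst (j ≤_) (sym tu) j≤i
    pw : OnPath w
    pw = subst (j ≤_) (sym tw) (m≤n⇒m≤1+n j≤i)
    u→w : suc (toℕ u) ≡ toℕ w
    u→w = trans (cong suc tu) (sym tw)
    u∈ : u ∈ initial (suc i)
    u∈ = ∈-initial⁺ (s≤s (≤-reflexive tu))
    w∉ : w ∉ initial (suc i)
    w∉ w∈ = <-irrefl tw (∈-initial⁻ w∈)

  zplus : IsZplus G (suc j)
  zplus = (initial (suc j) , ∣initial∣ (suc j) (s≤s (m≤m+n j m)) , initial-forcingSet m j refl ≤-refl)
        , λ _ → j<∣forcingSet∣

  -- The two ends of the path are both within distance pt of the single blue path vertex.
  pt-lowerBound : ∀ B s → ∣ B ∣ ≡ suc j → Full G (prop G B s) → ⌈ m /2⌉ ≤ s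
  pt-lowerBound B s ∣B∣≡ full with prop-meetsPath B s (full first) first-onPath
  ... | c , c∈B , pc = begin
    ⌈ m /2⌉                           ≤⟨ ⌈n/2⌉-mono m≤s+s ⟩
    ⌈ s + s /2⌉                       ≡⟨ sym (n≡⌈n+n/2⌉ s) ⟩
    s                                 ∎
    where
    open ≤-Reasoning
    I⊆B : initial j ⊆ B
    I⊆B v∈ = prop-isolated B s (full _) (∈-initial⁻ v∈)
    near : ∀ v → OnPath v → ∣ toℕ v - toℕ c ∣ ≤ s
    near v pv = prop⇒near (λ x∈ px → onPath-unique ∣B∣≡ I⊆B x∈ c∈B px pc) s (full v) pv
    last : Fin n
    last = vertex (j + m) ≤-refl
    near-last : ∣ j + m - toℕ c ∣ ≤ s
    near-last = subst (λ x → ∣ x - toℕ c ∣ ≤ s) (toℕ-vertex ≤-refl)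
                      (near last (subst (j ≤_) (sym (toℕ-vertex ≤-refl)) (m≤m+n j m)))
    near-first : ∣ toℕ c - j ∣ ≤ s
    near-first = subst (_≤ s)
                       (trans (cong (λ x → ∣ x - toℕ c ∣) (toℕ-vertex (m≤m+n j m))) (∣-∣-comm j (toℕ c)))
                       (near first first-onPath)
    m≤s+s : m ≤ s + s
    m≤s+s = begin
      m                                 ≡⟨ sym (m+n∸m≡n j m) ⟩
      j + m ∸ j                         ≤⟨ m∸n≤∣m-n∣ (j + m) j ⟩
      ∣ j + m - j ∣                     ≤⟨ ∣-∣-triangle (j + m) (toℕ c) j ⟩
      ∣ j + m - toℕ c ∣ + ∣ toℕ c - j ∣ ≤⟨ +-mono-≤ near-last near-first ⟩
      s + s                             ∎

  center : Fin n
  center = vertex (j + ⌊ m /2⌋) (+-monoʳ-≤ j (⌊n/2⌋≤n m))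

  toℕ-center : toℕ center ≡ j + ⌊ m /2⌋
  toℕ-center = toℕ-vertex (+-monoʳ-≤ j (⌊n/2⌋≤n m))

  center-onPath : OnPath center
  center-onPath = subst (j ≤_) (sym toℕ-center) (m≤m+n j ⌊ m /2⌋)

  centerSet : Subset n
  centerSet = initial j ∪ ⁅ center ⁆

  ∣centerSet∣ : ∣ centerSet ∣ ≡ suc j
  ∣centerSet∣ = trans (∣p∪⁅x⁆∣≡1+∣p∣ (onPath∉initial center-onPath)) (cong suc (∣initial∣ j j≤n))

  centerSet-onPath : ∀ {v} → v ∈ centerSet → OnPath v → v ≡ center
  centerSet-onPath v∈ pv = [ contradiction pv ∘ <⇒≱ ∘ ∈-initial⁻ , x∈⁅y⁆⇒x≡y center ]′ (x∈p∪q⁻ _ _ v∈)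

  near-center : ∀ v → OnPath v → ∣ toℕ v - toℕ center ∣ ≤ ⌈ m /2⌉
  near-center v pv = begin
    ∣ toℕ v - toℕ center ∣                ≡⟨ cong₂ ∣_-_∣ (sym (m+[n∸m]≡n pv)) toℕ-center ⟩
    ∣ j + (toℕ v ∸ j) - j + ⌊ m /2⌋ ∣     ≡⟨ ∣m+n-m+o∣≡∣n-o∣ j (toℕ v ∸ j) ⌊ m /2⌋ ⟩
    ∣ toℕ v ∸ j - ⌊ m /2⌋ ∣               ≤⟨ ∣-⌊/2⌋∣≤⌈/2⌉ m (m≤n+o⇒m∸n≤o (toℕ v) j (s≤s⁻¹ (toℕ<n v))) ⟩
    ⌈ m /2⌉                               ∎
    where open ≤-Reasoning

  centerSet-full : Full G (prop G centerSet ⌈ m /2⌉)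
  centerSet-full v with j ≤? toℕ v
  ... | yes pv = near⇒prop centerSet-onPath (x∈p∪q⁺ (inj₂ (x∈⁅x⁆ center))) center-onPath
                           ⌈ m /2⌉ pv (near-center v pv)
  ... | no ¬pv = ∈⇒prop G centerSet ⌈ m /2⌉ (x∈p∪q⁺ (inj₁ (∈-initial⁺ (≰⇒> ¬pv))))

  ptPlus : IsPtPlus G ⌈ m /2⌉
  ptPlus = suc j , zplus
         , (centerSet , ∣centerSet∣ , centerSet-full
           , λ s s< full → <⇒≱ s< (pt-lowerBound centerSet s ∣centerSet∣ full))
         , λ B s ∣B∣≡ (full , _) → pt-lowerBound B s ∣B∣≡ full

corollary4p7 : (n k : ℕ) → 1 ≤ k → k ≤ n →
    Σ (Graph n) λ G → IsZplus G k × IsPtPlus G ⌈ (n ∸ k) /2⌉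
corollary4p7 (suc n) (suc j) _ (s≤s j≤n) with m≤n⇒∃[o]m+o≡n j≤n
... | m , refl rewrite m+n∸m≡n j m = G , zplus , ptPlus
  where open IsolatedPlusPath j m
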